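{- If $G$ is a transitive permutation group acting on a finite set $\Omega$, then the exponent $\exp(G)$ divides $|G:\mathrm Z(G)|\,|\Omega/G^+|$.
   Context: $G^+$ denotes the subgroup of $G$ generated by all point-stabilisers $G_\omega$, $\omega\in\Omega$; $\Omega/G^+$ is the set of $G^+$-orbits on $\Omega$. $\mathrm Z(G)$ is the centre of $G$ and $\exp(G)$ the exponent of $G$. -}

module Defs where

open import Data.Nat using (ℕ; zero; suc; _≤_; NonZero)
open import Data.Fin using (Fin)
import Data.Fin.Properties as FinP
open import Data.Vec using (Vec; lookup; tabulate)
open import Data.Vec.Properties using (≡-dec)
open import Data.List using (List; []; _∷_; length; filter)
open import Data.List.Membership.Propositional using (_∈_)
open import Data.List.Relation.Unary.All using (All; all?)
open import Data.List.Relation.Unary.Unique.Propositional using (Unique)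
open import Data.List.Relation.Unary.AllPairs using (AllPairs)
open import Data.List.Relation.Unary.Any using (Any)
open import Data.Product using (Σ; ∃; _×_)
open import Relation.Nullary using (¬_; Dec)
open import Relation.Binary.PropositionalEquality using (_≡_)

-- A map Ω → Ω with Ω = Fin n, stored as its table of values
-- (so that equality of maps is decidable and is plain ≡).
Map : ℕ → Set
Map n = Vec (Fin n) n

_·_ : ∀ {n} → Map n → Fin n → Fin n
g · ω = lookup g ω

idMap : ∀ {n} → Map n
idMap = tabulate (λ ω → ω)

_∘ₘ_ : ∀ {n} → Map n → Map n → Map n
g ∘ₘ h = tabulate (λ ω → g · (h · ω))

_^ₘ_ : ∀ {n} → Map n → ℕ → Map n
g ^ₘ zero  = idMap
g ^ₘ suc k = g ∘ₘ (g ^ₘ k)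

_≟ₘ_ : ∀ {n} (g h : Map n) → Dec (g ≡ h)
_≟ₘ_ = ≡-dec FinP._≟_

IsPerm : ∀ {n} → Map n → Set
IsPerm g = ∀ α β → g · α ≡ g · β → α ≡ β

-- A permutation group on the finite set Ω = Fin n, given by the
-- duplicate-free list of its elements: a finite set of permutations
-- containing the identity and closed under composition (hence, being
-- finite, a subgroup of Sym(Ω)).
record PermGroup (n : ℕ) : Set where
  field
    elems    : List (Map n)
    unique   : Unique elems
    perms    : All IsPerm elems
    hasId    : idMap ∈ elems
    closed   : ∀ {g h} → g ∈ elems → h ∈ elems → (g ∘ₘ h) ∈ elems
open PermGroup public

order : ∀ {n} → PermGroup n → ℕ
order G = length (elems G)

centre : ∀ {n} → PermGroup n → List (Map n)
centre G = filter (λ g → all? (λ h → (g ∘ₘ h) ≟ₘ (h ∘ₘ g)) (elems G)) (elems G)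

centreOrder : ∀ {n} → PermGroup n → ℕ
centreOrder G = length (centre G)

Transitive : ∀ {n} → PermGroup n → Set
Transitive {n} G = ∀ (α β : Fin n) → ∃ λ g → g ∈ elems G × g · α ≡ β

IsExponent : ∀ {n} → PermGroup n → ℕ → Set
IsExponent G e =
  NonZero e × (∀ {g} → g ∈ elems G → g ^ₘ e ≡ idMap)
  × (∀ e′ → NonZero e′ → (∀ {g} → g ∈ elems G → g ^ₘ e′ ≡ idMap) → e ≤ e′)

IsCentreIndex : ∀ {n} → PermGroup n → ℕ → Set
IsCentreIndex G i = Data.Nat._*_ i (centreOrder G) ≡ order G

InStabiliser : ∀ {n} → PermGroup n → Map n → Set
InStabiliser {n} G g = g ∈ elems G × ∃ λ (ω : Fin n) → g · ω ≡ ω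

-- G⁺ = ⟨ G_ω : ω ∈ Ω ⟩ : products of finitely many elements of point
-- stabilisers (each G_ω is closed under inverses, so this is the
-- generated subgroup).
data InGplus {n} (G : PermGroup n) : Map n → Set where
  one  : InGplus G idMap
  mul  : ∀ {s h} → InStabiliser G s → InGplus G h → InGplus G (s ∘ₘ h)

SameGplusOrbit : ∀ {n} → PermGroup n → Fin n → Fin n → Set
SameGplusOrbit G α β = ∃ λ h → InGplus G h × h · α ≡ β

-- reps is a transversal of Ω/G⁺ (one point from each G⁺-orbit),
-- so |Ω/G⁺| = length reps
IsGplusOrbitTransversal : ∀ {n} → PermGroup n → List (Fin n) → Set
IsGplusOrbitTransversal {n} G reps =
  AllPairs (λ α β → ¬ SameGplusOrbit G α β) reps
  × (∀ (ω : Fin n) → Any (λ ρ → SameGplusOrbit G ρ ω) reps)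

module Submission where

-- Let Z = Z(G), T a left transversal of Z in G and N = |T| = |G : Z|.
-- The transfer V(g) = ∏_{t ∈ T} rep(gt)⁻¹ gt of G into Z is a
-- homomorphism, and splitting t ↦ rep(gt) into cycles shows V(g) = g^N;
-- so g ↦ g^N is a homomorphism G → Z.  In a transitive group a central
-- element fixing a point is trivial, hence s^N = 1 for all stabiliser
-- elements s and so for all of G⁺.  Thus g^N only depends on g·ρ₀, and
-- with b(ω)·ρ₀ = ω we get g^N b(ω)^N = b(π ω)^N for a permutation π of a
-- transversal R of Ω/G⁺; multiplying over R and cancelling the central
-- ∏ b(ω)^N gives g^{N|R|} = 1, and the exponent divides such a power.

open import Defs
open import Data.Nat using (ℕ; zero; suc; _*_; _+_; NonZero; _≤_; _<_; s≤s; s≤s⁻¹)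
open import Data.Nat.Properties
open import Data.Nat.Divisibility using (_∣_; m%n≡0⇒n∣m)
open import Data.Nat.DivMod using (_%_; _/_; m≡m%n+[m/n]*n; m%n<n)
open import Data.List using (List; []; _∷_; length; filter; map; _++_)
open import Data.List.Properties using (length-map; length-++; map-++; map-∘; map-cong-local)
open import Data.Fin using (Fin)
open import Data.Vec.Properties using (lookup∘tabulate; tabulate∘lookup; tabulate-cong)
open import Relation.Binary.PropositionalEquality hiding ([_])
open import Data.Product using (Σ; ∃; _×_; _,_; proj₁; proj₂)
open import Data.Sum using (_⊎_; inj₁; inj₂; [_,_])
open import Data.Empty using (⊥-elim)
open import Relation.Nullary using (¬_; Dec; yes; no; ¬?)
open import Function.Bundles using (mk⇔)
open import Function.Base using (_∘′_)
open import Data.List.Membership.Propositional using (_∈_; find; lose)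
open import Data.List.Membership.Propositional.Properties
  using (∈-filter⁺; ∈-filter⁻; ∈-map⁺; ∈-map⁻; ∈-++⁺ˡ; ∈-++⁺ʳ; ∈-++⁻)
open import Data.List.Membership.Propositional.Properties.WithK using (unique∧set⇒bag)
import Data.List.Membership.DecPropositional as DecMembership
open import Data.List.Relation.Unary.Unique.Propositional using (Unique)
import Data.List.Relation.Unary.Unique.Propositional.Properties as Unique
open import Data.List.Relation.Unary.AllPairs using (AllPairs; []; _∷_)
import Data.List.Relation.Unary.AllPairs as AllPairs
open import Data.List.Relation.Unary.All as All using (All; []; _∷_)
import Data.List.Relation.Unary.All.Properties as All
open import Data.List.Relation.Unary.Any using (Any; here; there; any?)
open import Data.List.Relation.Binary.Permutation.Propositional as ↭ using (_↭_)
import Data.List.Relation.Binary.Permutation.Propositional.Properties as ↭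
open import Data.List.Relation.Binary.BagAndSetEquality using (∼bag⇒↭)

-- The monoid of maps Fin n → Fin n

module _ {n : ℕ} where
  open ≡-Reasoning

  ·-∘ : (g h : Map n) (ω : Fin n) → (g ∘ₘ h) · ω ≡ g · (h · ω)
  ·-∘ g h ω = lookup∘tabulate (λ ω → g · (h · ω)) ω

  ·-id : (ω : Fin n) → idMap {n} · ω ≡ ω
  ·-id ω = lookup∘tabulate (λ ω → ω) ω

  map-ext : {g h : Map n} → (∀ ω → g · ω ≡ h · ω) → g ≡ h
  map-ext {g} {h} p = trans (sym (tabulate∘lookup g)) (trans (tabulate-cong p) (tabulate∘lookup h))

  ∘-assoc : (g h k : Map n) → (g ∘ₘ h) ∘ₘ k ≡ g ∘ₘ (h ∘ₘ k)
  ∘-assoc g h k = map-ext λ ω → begin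
    ((g ∘ₘ h) ∘ₘ k) · ω  ≡⟨ ·-∘ (g ∘ₘ h) k ω ⟩
    (g ∘ₘ h) · (k · ω)   ≡⟨ ·-∘ g h (k · ω) ⟩
    g · (h · (k · ω))    ≡⟨ cong (g ·_) (sym (·-∘ h k ω)) ⟩
    g · ((h ∘ₘ k) · ω)   ≡⟨ sym (·-∘ g (h ∘ₘ k) ω) ⟩
    (g ∘ₘ (h ∘ₘ k)) · ω  ∎

  ∘-identityˡ : (g : Map n) → idMap ∘ₘ g ≡ g
  ∘-identityˡ g = map-ext λ ω → trans (·-∘ idMap g ω) (·-id (g · ω))

  ∘-identityʳ : (g : Map n) → g ∘ₘ idMap ≡ g
  ∘-identityʳ g = map-ext λ ω → trans (·-∘ g idMap ω) (cong (g ·_) (·-id ω))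

  ^-+ : (g : Map n) (a b : ℕ) → g ^ₘ (a + b) ≡ (g ^ₘ a) ∘ₘ (g ^ₘ b)
  ^-+ g zero    b = sym (∘-identityˡ (g ^ₘ b))
  ^-+ g (suc a) b = trans (cong (g ∘ₘ_) (^-+ g a b)) (sym (∘-assoc g (g ^ₘ a) (g ^ₘ b)))

  ^-* : (g : Map n) (a b : ℕ) → (g ^ₘ a) ^ₘ b ≡ g ^ₘ (b * a)
  ^-* g a zero    = refl
  ^-* g a (suc b) = trans (cong ((g ^ₘ a) ∘ₘ_) (^-* g a b)) (sym (^-+ g a (b * a)))

  ^-swap : (g : Map n) (a b : ℕ) → (g ^ₘ a) ^ₘ b ≡ (g ^ₘ b) ^ₘ a
  ^-swap g a b = trans (^-* g a b) (trans (cong (g ^ₘ_) (*-comm b a)) (sym (^-* g b a)))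

  idMap-^ : (k : ℕ) → idMap {n} ^ₘ k ≡ idMap
  idMap-^ zero    = refl
  idMap-^ (suc k) = trans (cong (idMap ∘ₘ_) (idMap-^ k)) (∘-identityˡ idMap)

  ^-commute : (g : Map n) (a : ℕ) → (g ^ₘ a) ∘ₘ g ≡ g ∘ₘ (g ^ₘ a)
  ^-commute g zero    = trans (∘-identityˡ g) (sym (∘-identityʳ g))
  ^-commute g (suc a) = trans (∘-assoc g (g ^ₘ a) g) (cong (g ∘ₘ_) (^-commute g a))

  ^-fixes : (g : Map n) (ω : Fin n) → g · ω ≡ ω → ∀ k → (g ^ₘ k) · ω ≡ ω
  ^-fixes g ω p zero    = ·-id ω
  ^-fixes g ω p (suc k) = trans (·-∘ g (g ^ₘ k) ω) (trans (cong (g ·_) (^-fixes g ω p k)) p)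

  prod : List (Map n) → Map n
  prod []       = idMap
  prod (x ∷ xs) = x ∘ₘ prod xs

  prod-++ : (xs ys : List (Map n)) → prod (xs ++ ys) ≡ prod xs ∘ₘ prod ys
  prod-++ []       ys = sym (∘-identityˡ (prod ys))
  prod-++ (x ∷ xs) ys = trans (cong (x ∘ₘ_) (prod-++ xs ys)) (sym (∘-assoc x (prod xs) (prod ys)))

  prod-const : ∀ {A : Set} (z : Map n) (xs : List A) → prod (map (λ _ → z) xs) ≡ z ^ₘ length xs
  prod-const z []       = refl
  prod-const z (x ∷ xs) = cong (z ∘ₘ_) (prod-const z xs)

unique-↭ : ∀ {A : Set} {xs ys : List A} → Unique xs → Unique ys →
           (∀ {x} → x ∈ xs → x ∈ ys) → (∀ {x} → x ∈ ys → x ∈ xs) → xs ↭ ys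
unique-↭ u v f g = ∼bag⇒↭ (unique∧set⇒bag u v (mk⇔ f g))

unique-map⁺ : ∀ {A B : Set} (f : A → B) {xs : List A} →
              (∀ {x y} → x ∈ xs → y ∈ xs → f x ≡ f y → x ≡ y) → Unique xs → Unique (map f xs)
unique-map⁺ f {[]}     inj []       = []
unique-map⁺ f {x ∷ xs} inj (x∉ ∷ u) =
  All.tabulate (λ {v} v∈ fx≡v →
    let (y , y∈ , v≡fy) = ∈-map⁻ f v∈ in All.lookup x∉ y∈ (inj (here refl) (there y∈) (trans fx≡v v≡fy)))
  ∷ unique-map⁺ f (λ p q → inj (there p) (there q)) u

module LeastWitness {P : ℕ → Set} (P? : ∀ k → Dec (P k)) where
  Least : ℕ → Set
  Least m = P m × (∀ j → j < m → ¬ P j)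

  search : ∀ N → (∀ j → j < N → ¬ P j) ⊎ ∃ Least
  search zero = inj₁ (λ j ())
  search (suc N) with search N
  ... | inj₂ found = inj₂ found
  ... | inj₁ none with P? N
  ...   | yes pN  = inj₂ (N , pN , none)
  ...   | no ¬pN  = inj₁ (λ j j<1+N → [ none j , (λ { refl → ¬pN }) ] (m<1+n⇒m<n∨m≡n j<1+N))

  least : ∀ N → P N → ∃ Least
  least N pN with search (suc N)
  ... | inj₁ none  = ⊥-elim (none N (n<1+n N) pN)
  ... | inj₂ found = found

-- A finite group G of maps in which every element satisfies g^(e'+1) = 1;
-- inverses are then the powers g^e'.

module FiniteGroup {n : ℕ} (G : PermGroup n) (e' : ℕ)
                   (power-id : ∀ {g} → g ∈ elems G → g ^ₘ suc e' ≡ idMap) where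
  open ≡-Reasoning

  InG : Map n → Set
  InG g = g ∈ elems G

  ∘∈ : ∀ {g h} → InG g → InG h → InG (g ∘ₘ h)
  ∘∈ = closed G

  ^∈ : ∀ {g} → InG g → ∀ k → InG (g ^ₘ k)
  ^∈ p zero    = hasId G
  ^∈ p (suc k) = ∘∈ p (^∈ p k)

  inv : Map n → Map n
  inv g = g ^ₘ e'

  inv∈ : ∀ {g} → InG g → InG (inv g)
  inv∈ p = ^∈ p e'

  inverseʳ : ∀ {g} → InG g → g ∘ₘ inv g ≡ idMap
  inverseʳ = power-id

  inverseˡ : ∀ {g} → InG g → inv g ∘ₘ g ≡ idMap
  inverseˡ {g} p = trans (^-commute g e') (power-id p)

  inv-cancelˡ : ∀ {g} x → InG g → inv g ∘ₘ (g ∘ₘ x) ≡ x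
  inv-cancelˡ {g} x p = trans (sym (∘-assoc (inv g) g x)) (trans (cong (_∘ₘ x) (inverseˡ p)) (∘-identityˡ x))

  inv-cancelˡ′ : ∀ {g} x → InG g → g ∘ₘ (inv g ∘ₘ x) ≡ x
  inv-cancelˡ′ {g} x p = trans (sym (∘-assoc g (inv g) x)) (trans (cong (_∘ₘ x) (inverseʳ p)) (∘-identityˡ x))

  inv-cancelʳ : ∀ {g} x → InG g → (x ∘ₘ g) ∘ₘ inv g ≡ x
  inv-cancelʳ {g} x p = trans (∘-assoc x g (inv g)) (trans (cong (x ∘ₘ_) (inverseʳ p)) (∘-identityʳ x))

  inv-cancelʳ′ : ∀ {g} x → InG g → (x ∘ₘ inv g) ∘ₘ g ≡ x
  inv-cancelʳ′ {g} x p = trans (∘-assoc x (inv g) g) (trans (cong (x ∘ₘ_) (inverseˡ p)) (∘-identityʳ x))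

  cancelˡ : ∀ {g x y} → InG g → g ∘ₘ x ≡ g ∘ₘ y → x ≡ y
  cancelˡ {g} {x} {y} p eq = trans (sym (inv-cancelˡ x p)) (trans (cong (inv g ∘ₘ_) eq) (inv-cancelˡ y p))

  cancelʳ : ∀ {g x y} → InG g → x ∘ₘ g ≡ y ∘ₘ g → x ≡ y
  cancelʳ {g} {x} {y} p eq = trans (sym (inv-cancelʳ x p)) (trans (cong (_∘ₘ inv g) eq) (inv-cancelʳ y p))

  ·-inv : ∀ {g} ω → InG g → inv g · (g · ω) ≡ ω
  ·-inv {g} ω p = trans (sym (·-∘ (inv g) g ω)) (trans (cong (_· ω) (inverseˡ p)) (·-id ω))

  ·-inv′ : ∀ {g} ω → InG g → g · (inv g · ω) ≡ ω
  ·-inv′ {g} ω p = trans (sym (·-∘ g (inv g) ω)) (trans (cong (_· ω) (inverseʳ p)) (·-id ω))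

  inv-^-id : ∀ {h} N → h ^ₘ N ≡ idMap → inv h ^ₘ N ≡ idMap
  inv-^-id {h} N hN = trans (^-swap h e' N) (trans (cong (_^ₘ e') hN) (idMap-^ e'))

  Z : List (Map n)
  Z = centre G

  InZ : Map n → Set
  InZ g = g ∈ Z

  central? : (g : Map n) → Dec (All (λ h → g ∘ₘ h ≡ h ∘ₘ g) (elems G))
  central? g = All.all? (λ h → (g ∘ₘ h) ≟ₘ (h ∘ₘ g)) (elems G)

  Z⊆G : ∀ {z} → InZ z → InG z
  Z⊆G p = proj₁ (∈-filter⁻ central? {xs = elems G} p)

  Z-commutes : ∀ {z h} → InZ z → InG h → z ∘ₘ h ≡ h ∘ₘ z
  Z-commutes p q = All.lookup (proj₂ (∈-filter⁻ central? {xs = elems G} p)) q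

  Z-intro : ∀ {z} → InG z → (∀ {h} → InG h → z ∘ₘ h ≡ h ∘ₘ z) → InZ z
  Z-intro q c = ∈-filter⁺ central? q (All.tabulate c)

  id∈Z : InZ idMap
  id∈Z = Z-intro (hasId G) (λ {h} _ → trans (∘-identityˡ h) (sym (∘-identityʳ h)))

  ∘∈Z : ∀ {a b} → InZ a → InZ b → InZ (a ∘ₘ b)
  ∘∈Z {a} {b} pa pb = Z-intro (∘∈ (Z⊆G pa) (Z⊆G pb)) λ {h} hp → begin
    (a ∘ₘ b) ∘ₘ h  ≡⟨ ∘-assoc a b h ⟩
    a ∘ₘ (b ∘ₘ h)  ≡⟨ cong (a ∘ₘ_) (Z-commutes pb hp) ⟩
    a ∘ₘ (h ∘ₘ b)  ≡⟨ sym (∘-assoc a h b) ⟩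
    (a ∘ₘ h) ∘ₘ b  ≡⟨ cong (_∘ₘ b) (Z-commutes pa hp) ⟩
    (h ∘ₘ a) ∘ₘ b  ≡⟨ ∘-assoc h a b ⟩
    h ∘ₘ (a ∘ₘ b)  ∎

  inv∈Z : ∀ {z} → InZ z → InZ (inv z)
  inv∈Z {z} p = power∈Z e'
    where
      power∈Z : ∀ k → InZ (z ^ₘ k)
      power∈Z zero    = id∈Z
      power∈Z (suc k) = ∘∈Z p (power∈Z k)

  unique-Z : Unique Z
  unique-Z = Unique.filter⁺ central? (unique G)

  Z-nonempty : NonZero (length Z)
  Z-nonempty = nonZero id∈Z
    where
      nonZero : ∀ {x : Map n} {xs} → x ∈ xs → NonZero (length xs)
      nonZero (here _)  = _
      nonZero (there _) = _

  prod∈Z : ∀ {xs} → All InZ xs → InZ (prod xs)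
  prod∈Z []      = id∈Z
  prod∈Z (p ∷ a) = ∘∈Z p (prod∈Z a)

  prod-↭ : ∀ {xs ys} → xs ↭ ys → All InZ xs → prod xs ≡ prod ys
  prod-↭ ↭.refl          a       = refl
  prod-↭ (↭.prep x p)    (_ ∷ a) = cong (x ∘ₘ_) (prod-↭ p a)
  prod-↭ {x ∷ y ∷ xs} {.y ∷ .x ∷ ys} (↭.swap .x .y p) (px ∷ py ∷ a) = begin
    x ∘ₘ (y ∘ₘ prod xs)  ≡⟨ cong (λ w → x ∘ₘ (y ∘ₘ w)) (prod-↭ p a) ⟩
    x ∘ₘ (y ∘ₘ prod ys)  ≡⟨ sym (∘-assoc x y (prod ys)) ⟩
    (x ∘ₘ y) ∘ₘ prod ys  ≡⟨ cong (_∘ₘ prod ys) (Z-commutes px (Z⊆G py)) ⟩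
    (y ∘ₘ x) ∘ₘ prod ys  ≡⟨ ∘-assoc y x (prod ys) ⟩
    y ∘ₘ (x ∘ₘ prod ys)  ∎
  prod-↭ (↭.trans p q) a = trans (prod-↭ p a) (prod-↭ q (↭.All-resp-↭ p a))

  prod-map-∘ : ∀ {A : Set} (f h : A → Map n) (xs : List A) →
               (∀ {x} → x ∈ xs → InZ (f x)) → (∀ {x} → x ∈ xs → InZ (h x)) →
               prod (map (λ x → f x ∘ₘ h x) xs) ≡ prod (map f xs) ∘ₘ prod (map h xs)
  prod-map-∘ f h []       _  _  = sym (∘-identityˡ idMap)
  prod-map-∘ f h (x ∷ xs) zf zh = begin
    (f x ∘ₘ h x) ∘ₘ prod (map (λ x → f x ∘ₘ h x) xs)
      ≡⟨ cong ((f x ∘ₘ h x) ∘ₘ_) (prod-map-∘ f h xs (zf ∘′ there) (zh ∘′ there)) ⟩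
    (f x ∘ₘ h x) ∘ₘ (F ∘ₘ H)   ≡⟨ ∘-assoc (f x) (h x) (F ∘ₘ H) ⟩
    f x ∘ₘ (h x ∘ₘ (F ∘ₘ H))   ≡⟨ cong (f x ∘ₘ_) (sym (∘-assoc (h x) F H)) ⟩
    f x ∘ₘ ((h x ∘ₘ F) ∘ₘ H)   ≡⟨ cong (λ w → f x ∘ₘ (w ∘ₘ H)) (Z-commutes (zh (here refl)) (Z⊆G F∈Z)) ⟩
    f x ∘ₘ ((F ∘ₘ h x) ∘ₘ H)   ≡⟨ cong (f x ∘ₘ_) (∘-assoc F (h x) H) ⟩
    f x ∘ₘ (F ∘ₘ (h x ∘ₘ H))   ≡⟨ sym (∘-assoc (f x) F (h x ∘ₘ H)) ⟩
    (f x ∘ₘ F) ∘ₘ (h x ∘ₘ H)   ∎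
    where
      F = prod (map f xs)
      H = prod (map h xs)
      F∈Z : InZ F
      F∈Z = prod∈Z (All.map⁺ (All.tabulate (zf ∘′ there)))

  _~_ : Map n → Map n → Set
  x ~ y = Any (λ z → y ≡ x ∘ₘ z) Z

  _~?_ : ∀ x y → Dec (x ~ y)
  x ~? y = any? (λ z → y ≟ₘ (x ∘ₘ z)) Z

  ~-refl : ∀ x → x ~ x
  ~-refl x = lose id∈Z (sym (∘-identityʳ x))

  ~-sym : ∀ {x y} → x ~ y → y ~ x
  ~-sym {x} {y} r with find r
  ... | z , z∈ , y≡xz = lose (inv∈Z z∈) (sym (begin
    y ∘ₘ inv z         ≡⟨ cong (_∘ₘ inv z) y≡xz ⟩
    (x ∘ₘ z) ∘ₘ inv z  ≡⟨ inv-cancelʳ x (Z⊆G z∈) ⟩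
    x                  ∎))

  ~-trans : ∀ {x y w} → x ~ y → y ~ w → x ~ w
  ~-trans {x} {y} {w} r s with find r | find s
  ... | z , z∈ , y≡xz | z′ , z′∈ , w≡yz′ = lose (∘∈Z z∈ z′∈) (begin
    w               ≡⟨ w≡yz′ ⟩
    y ∘ₘ z′         ≡⟨ cong (_∘ₘ z′) y≡xz ⟩
    (x ∘ₘ z) ∘ₘ z′  ≡⟨ ∘-assoc x z z′ ⟩
    x ∘ₘ (z ∘ₘ z′)  ∎)

  ~-left : ∀ {x y} h → x ~ y → (h ∘ₘ x) ~ (h ∘ₘ y)
  ~-left {x} {y} h r with find r
  ... | z , z∈ , y≡xz = lose z∈ (trans (cong (h ∘ₘ_) y≡xz) (sym (∘-assoc h x z)))

  ~-unleft : ∀ {x y h} → InG h → (h ∘ₘ x) ~ (h ∘ₘ y) → x ~ y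
  ~-unleft {x} {y} {h} hp r with find r
  ... | z , z∈ , eq = lose z∈ (cancelˡ hp (trans eq (∘-assoc h x z)))

  ~⇒quotient∈Z : ∀ {x y} → InG x → x ~ y → InZ (inv x ∘ₘ y)
  ~⇒quotient∈Z {x} {y} p r with find r
  ... | z , z∈ , y≡xz = subst InZ (sym (trans (cong (inv x ∘ₘ_) y≡xz) (inv-cancelˡ z p))) z∈

  pick : Map n → List (Map n) → Map n
  pick x []       = x
  pick x (y ∷ ys) with y ~? x
  ... | yes _ = y
  ... | no  _ = pick x ys

  pick-spec : ∀ x ys → Any (_~ x) ys → pick x ys ∈ ys × pick x ys ~ x
  pick-spec x (y ∷ ys) a with y ~? x
  ... | yes y~x = here refl , y~x
  ... | no ¬y~x with a
  ...   | here y~x = ⊥-elim (¬y~x y~x)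
  ...   | there a′ = let (m , r) = pick-spec x ys a′ in there m , r

  pick-cong : ∀ x x′ ys → x ~ x′ → Any (_~ x) ys → pick x ys ≡ pick x′ ys
  pick-cong x x′ (y ∷ ys) r a with y ~? x | y ~? x′
  ... | yes _   | yes _    = refl
  ... | yes y~x | no ¬y~x′ = ⊥-elim (¬y~x′ (~-trans {y} {x} {x′} y~x r))
  ... | no ¬y~x | yes y~x′ = ⊥-elim (¬y~x (~-trans {y} {x′} {x} y~x′ (~-sym {x} {x′} r)))
  ... | no ¬y~x | no _ with a
  ...   | here y~x = ⊥-elim (¬y~x y~x)
  ...   | there a′ = pick-cong x x′ ys r a′

  -- rep x is the chosen representative of xZ, and T the transversal of
  -- all chosen representatives; both are only used through their
  -- specifications.
  opaque
    rep : Map n → Map n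
    rep x = pick x (elems G)

    rep∈ : ∀ {x} → InG x → InG (rep x)
    rep∈ {x} p = proj₁ (pick-spec x (elems G) (lose p (~-refl x)))

    rep~ : ∀ {x} → InG x → rep x ~ x
    rep~ {x} p = proj₂ (pick-spec x (elems G) (lose p (~-refl x)))

    rep-cong : ∀ {x x′} → InG x → x ~ x′ → rep x ≡ rep x′
    rep-cong {x} {x′} p r = pick-cong x x′ (elems G) r (lose p (~-refl x))

    T : List (Map n)
    T = filter (λ x → rep x ≟ₘ x) (elems G)

    T⁻ : ∀ {t} → t ∈ T → InG t × rep t ≡ t
    T⁻ p = ∈-filter⁻ (λ x → rep x ≟ₘ x) {xs = elems G} p

    T⁺ : ∀ {t} → InG t → rep t ≡ t → t ∈ T
    T⁺ p q = ∈-filter⁺ (λ x → rep x ≟ₘ x) p q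

    unique-T : Unique T
    unique-T = Unique.filter⁺ (λ x → rep x ≟ₘ x) (unique G)

  T⊆G : ∀ {t} → t ∈ T → InG t
  T⊆G tT = proj₁ (T⁻ tT)

  rep∈T : ∀ {x} → InG x → rep x ∈ T
  rep∈T p = T⁺ (rep∈ p) (rep-cong (rep∈ p) (rep~ p))

  T-injective : ∀ {t t′} → t ∈ T → t′ ∈ T → t ~ t′ → t ≡ t′
  T-injective tT t′T r = trans (sym (proj₂ (T⁻ tT))) (trans (rep-cong (T⊆G tT) r) (proj₂ (T⁻ t′T)))

  N : ℕ
  N = length T

  cosets : List (Map n) → List (Map n)
  cosets []       = []
  cosets (t ∷ ts) = map (t ∘ₘ_) Z ++ cosets ts

  length-cosets : ∀ ts → length (cosets ts) ≡ length ts * length Z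
  length-cosets []       = refl
  length-cosets (t ∷ ts) =
    trans (length-++ (map (t ∘ₘ_) Z)) (cong₂ _+_ (length-map (t ∘ₘ_) Z) (length-cosets ts))

  ∈-cosets⁻ : ∀ {v} ts → v ∈ cosets ts → ∃ λ t → t ∈ ts × ∃ λ z → InZ z × v ≡ t ∘ₘ z
  ∈-cosets⁻ (t ∷ ts) v∈ with ∈-++⁻ (map (t ∘ₘ_) Z) v∈
  ... | inj₁ v∈tZ = let (z , z∈ , eq) = ∈-map⁻ (t ∘ₘ_) v∈tZ in t , here refl , z , z∈ , eq
  ... | inj₂ v∈ts = let (t′ , t′∈ , rest) = ∈-cosets⁻ ts v∈ts in t′ , there t′∈ , rest

  ∈-cosets⁺ : ∀ {v t} ts → t ∈ ts → v ∈ map (t ∘ₘ_) Z → v ∈ cosets ts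
  ∈-cosets⁺ (t ∷ ts)  (here refl) v∈ = ∈-++⁺ˡ v∈
  ∈-cosets⁺ (t′ ∷ ts) (there t∈) v∈ = ∈-++⁺ʳ (map (t′ ∘ₘ_) Z) (∈-cosets⁺ ts t∈ v∈)

  unique-cosets : ∀ ts → Unique ts → All (_∈ T) ts → Unique (cosets ts)
  unique-cosets []       _        _          = []
  unique-cosets (t ∷ ts) (t∉ ∷ u) (tT ∷ tsT) =
    Unique.++⁺ (Unique.map⁺ (cancelˡ (T⊆G tT)) unique-Z) (unique-cosets ts u tsT) disjoint
    where
      disjoint : ∀ {v} → ¬ (v ∈ map (t ∘ₘ_) Z × v ∈ cosets ts)
      disjoint (v∈tZ , v∈ts) =
        let (z , z∈ , v≡tz) = ∈-map⁻ (t ∘ₘ_) v∈tZ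
            (t′ , t′∈ , z′ , z′∈ , v≡t′z′) = ∈-cosets⁻ ts v∈ts
            t~t′ : t ~ t′
            t~t′ = ~-trans {t} {_} {t′} (lose z∈ v≡tz) (~-sym {t′} (lose z′∈ v≡t′z′))
        in All.lookup t∉ t′∈ (T-injective tT (All.lookup tsT t′∈) t~t′)

  cosets-T↭G : cosets T ↭ elems G
  cosets-T↭G = unique-↭ (unique-cosets T unique-T (All.tabulate (λ t∈ → t∈))) (unique G) ⊆G G⊆
    where
      ⊆G : ∀ {x} → x ∈ cosets T → x ∈ elems G
      ⊆G x∈ = let (t , t∈ , z , z∈ , x≡tz) = ∈-cosets⁻ T x∈ in
        subst InG (sym x≡tz) (∘∈ (T⊆G t∈) (Z⊆G z∈))
      G⊆ : ∀ {x} → x ∈ elems G → x ∈ cosets T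
      G⊆ {x} x∈ = let (z , z∈ , x≡rz) = find (rep~ x∈) in
        ∈-cosets⁺ T (rep∈T x∈) (subst (_∈ map (rep x ∘ₘ_) Z) (sym x≡rz) (∈-map⁺ (rep x ∘ₘ_) z∈))

  index-formula : N * length Z ≡ order G
  index-formula = trans (sym (length-cosets T)) (↭.↭-length cosets-T↭G)

  shift : Map n → Map n → Map n
  shift h t = rep (h ∘ₘ t)

  shift∈T : ∀ {h t} → InG h → t ∈ T → shift h t ∈ T
  shift∈T hp tT = rep∈T (∘∈ hp (T⊆G tT))

  rep-left : ∀ {g x} → InG g → InG x → rep (g ∘ₘ rep x) ≡ rep (g ∘ₘ x)
  rep-left {g} {x} gp xp = rep-cong (∘∈ gp (rep∈ xp)) (~-left {rep x} {x} g (rep~ xp))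

  shift-injective : ∀ {h x y} → InG h → x ∈ T → y ∈ T → shift h x ≡ shift h y → x ≡ y
  shift-injective {h} {x} {y} hp xT yT eq = T-injective xT yT (~-unleft {x} {y} {h} hp hx~hy)
    where
      hx~ry : (h ∘ₘ x) ~ rep (h ∘ₘ y)
      hx~ry = subst ((h ∘ₘ x) ~_) eq (~-sym {rep (h ∘ₘ x)} (rep~ (∘∈ hp (T⊆G xT))))
      hx~hy : (h ∘ₘ x) ~ (h ∘ₘ y)
      hx~hy = ~-trans {h ∘ₘ x} {rep (h ∘ₘ y)} hx~ry (rep~ (∘∈ hp (T⊆G yT)))

  shift-↭ : ∀ {h} → InG h → map (shift h) T ↭ T
  shift-↭ {h} hp = unique-↭ (unique-map⁺ (shift h) (shift-injective hp) unique-T) unique-T ⊆T T⊆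
    where
      ⊆T : ∀ {x} → x ∈ map (shift h) T → x ∈ T
      ⊆T x∈ = let (t , t∈ , x≡) = ∈-map⁻ (shift h) x∈ in subst (_∈ T) (sym x≡) (shift∈T hp t∈)
      -- t = shift h (rep (h⁻¹ t))
      T⊆ : ∀ {t} → t ∈ T → t ∈ map (shift h) T
      T⊆ {t} tT = subst (_∈ map (shift h) T) shift-x≡t (∈-map⁺ (shift h) (rep∈T y∈))
        where
          y∈ = ∘∈ (inv∈ hp) (T⊆G tT)
          shift-x≡t : shift h (rep (inv h ∘ₘ t)) ≡ t
          shift-x≡t = begin
            rep (h ∘ₘ rep (inv h ∘ₘ t))  ≡⟨ rep-left hp y∈ ⟩
            rep (h ∘ₘ (inv h ∘ₘ t))      ≡⟨ cong rep (inv-cancelˡ′ t hp) ⟩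
            rep t                        ≡⟨ proj₂ (T⁻ tT) ⟩
            t                            ∎

  -- The transfer V : G → Z,  V(g) = ∏_{t ∈ T} τ(g,t)

  τ : Map n → Map n → Map n
  τ g t = inv (shift g t) ∘ₘ (g ∘ₘ t)

  τ∈Z : ∀ {g t} → InG g → InG t → InZ (τ g t)
  τ∈Z gp tp = ~⇒quotient∈Z (rep∈ (∘∈ gp tp)) (rep~ (∘∈ gp tp))

  V : Map n → Map n
  V g = prod (map (τ g) T)

  V∈Z : ∀ {g} → InG g → InZ (V g)
  V∈Z gp = prod∈Z (All.map⁺ (All.tabulate (λ t∈ → τ∈Z gp (T⊆G t∈))))

  τ-cocycle : ∀ {g h t} → InG g → InG h → InG t → τ (g ∘ₘ h) t ≡ τ g (shift h t) ∘ₘ τ h t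
  τ-cocycle {g} {h} {t} gp hp tp = sym (begin
    (inv (rep (g ∘ₘ r)) ∘ₘ (g ∘ₘ r)) ∘ₘ (inv r ∘ₘ (h ∘ₘ t))
      ≡⟨ cong (λ w → (inv w ∘ₘ (g ∘ₘ r)) ∘ₘ (inv r ∘ₘ (h ∘ₘ t))) R≡ ⟩
    (inv R ∘ₘ (g ∘ₘ r)) ∘ₘ (inv r ∘ₘ (h ∘ₘ t))   ≡⟨ ∘-assoc (inv R) (g ∘ₘ r) (inv r ∘ₘ (h ∘ₘ t)) ⟩
    inv R ∘ₘ ((g ∘ₘ r) ∘ₘ (inv r ∘ₘ (h ∘ₘ t)))   ≡⟨ cong (inv R ∘ₘ_) (∘-assoc g r (inv r ∘ₘ (h ∘ₘ t))) ⟩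
    inv R ∘ₘ (g ∘ₘ (r ∘ₘ (inv r ∘ₘ (h ∘ₘ t))))   ≡⟨ cong (λ w → inv R ∘ₘ (g ∘ₘ w)) (inv-cancelˡ′ (h ∘ₘ t) r∈) ⟩
    inv R ∘ₘ (g ∘ₘ (h ∘ₘ t))                     ≡⟨ cong (inv R ∘ₘ_) (sym (∘-assoc g h t)) ⟩
    inv R ∘ₘ ((g ∘ₘ h) ∘ₘ t)                     ∎)
    where
      r  = shift h t
      r∈ = rep∈ (∘∈ hp tp)
      R  = shift (g ∘ₘ h) t
      R≡ : rep (g ∘ₘ r) ≡ R
      R≡ = trans (rep-left gp (∘∈ hp tp)) (cong rep (sym (∘-assoc g h t)))

  V-hom : ∀ {g h} → InG g → InG h → V (g ∘ₘ h) ≡ V g ∘ₘ V h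
  V-hom {g} {h} gp hp = begin
    prod (map (τ (g ∘ₘ h)) T)
      ≡⟨ cong prod (map-cong-local (All.tabulate (λ t∈ → τ-cocycle gp hp (T⊆G t∈)))) ⟩
    prod (map (λ t → τ g (shift h t) ∘ₘ τ h t) T)
      ≡⟨ prod-map-∘ (λ t → τ g (shift h t)) (τ h) T
           (λ t∈ → τ∈Z gp (T⊆G (shift∈T hp t∈))) (λ t∈ → τ∈Z hp (T⊆G t∈)) ⟩
    prod (map (λ t → τ g (shift h t)) T) ∘ₘ V h
      ≡⟨ cong (λ w → prod w ∘ₘ V h) (map-∘ T) ⟩
    prod (map (τ g) (map (shift h) T)) ∘ₘ V h
      ≡⟨ cong (_∘ₘ V h) (prod-↭ (↭.map⁺ (τ g) (shift-↭ hp)) τ-central) ⟩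
    V g ∘ₘ V h ∎
    where
      τ-central : All InZ (map (τ g) (map (shift h) T))
      τ-central = All.map⁺ (All.tabulate (λ x∈ →
        let (t , t∈ , x≡) = ∈-map⁻ (shift h) x∈ in
        τ∈Z gp (T⊆G (subst (_∈ T) (sym x≡) (shift∈T hp t∈)))))

  -- Evaluation of the transfer: V(g) = g^N

  module Evaluation {g : Map n} (gp : InG g) where

    φ : Map n → Map n
    φ = shift g

    Closed : List (Map n) → Set
    Closed R = ∀ {t} → t ∈ R → φ t ∈ R

    -- The φ-cycle through t ∈ T: u j = φʲ t has least period p, and the
    -- product of τ(g,-) over the cycle telescopes to t⁻¹ gᵖ t = gᵖ.
    module Cycle {t : Map n} (tT : t ∈ T) where
      t∈G : InG t
      t∈G = T⊆G tT

      u : ℕ → Map n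
      u zero    = t
      u (suc j) = φ (u j)

      u∈T : ∀ j → u j ∈ T
      u∈T zero    = tT
      u∈T (suc j) = shift∈T gp (u∈T j)

      u∈G : ∀ j → InG (u j)
      u∈G j = T⊆G (u∈T j)

      gʲt∈G : ∀ j → InG ((g ^ₘ j) ∘ₘ t)
      gʲt∈G j = ∘∈ (^∈ gp j) t∈G

      u≡rep : ∀ j → u j ≡ rep ((g ^ₘ j) ∘ₘ t)
      u≡rep zero    = sym (trans (cong rep (∘-identityˡ t)) (proj₂ (T⁻ tT)))
      u≡rep (suc j) = begin
        rep (g ∘ₘ u j)                    ≡⟨ cong (λ w → rep (g ∘ₘ w)) (u≡rep j) ⟩
        rep (g ∘ₘ rep ((g ^ₘ j) ∘ₘ t))    ≡⟨ rep-left gp (gʲt∈G j) ⟩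
        rep (g ∘ₘ ((g ^ₘ j) ∘ₘ t))        ≡⟨ cong rep (sym (∘-assoc g (g ^ₘ j) t)) ⟩
        rep ((g ^ₘ suc j) ∘ₘ t)           ∎

      u-returns : u (suc e') ≡ t
      u-returns = begin
        u (suc e')                   ≡⟨ u≡rep (suc e') ⟩
        rep ((g ^ₘ suc e') ∘ₘ t)     ≡⟨ cong (λ w → rep (w ∘ₘ t)) (power-id gp) ⟩
        rep (idMap ∘ₘ t)             ≡⟨ cong rep (∘-identityˡ t) ⟩
        rep t                        ≡⟨ proj₂ (T⁻ tT) ⟩
        t                            ∎

      open LeastWitness (λ j → u (suc j) ≟ₘ t) using (least)

      -- p = m + 1 is the least period of u
      opaque
        m : ℕ
        m = proj₁ (least e' u-returns)

        u-period : u (suc m) ≡ t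
        u-period = proj₁ (proj₂ (least e' u-returns))

        u-minimal : ∀ j → j < m → u (suc j) ≢ t
        u-minimal = proj₂ (proj₂ (least e' u-returns))

      p : ℕ
      p = suc m

      u-cancel : ∀ a d → u a ≡ u (a + d) → t ≡ u d
      u-cancel zero    d eq = eq
      u-cancel (suc a) d eq = u-cancel a d (shift-injective gp (u∈T a) (u∈T (a + d)) eq)

      orbit : ℕ → List (Map n)
      orbit zero    = []
      orbit (suc j) = orbit j ++ (u j ∷ [])

      ∈-orbit⁻ : ∀ j {x} → x ∈ orbit j → ∃ λ i → i < j × x ≡ u i
      ∈-orbit⁻ (suc j) x∈ with ∈-++⁻ (orbit j) x∈
      ... | inj₁ x∈′         = let (i , i<j , eq) = ∈-orbit⁻ j x∈′ in i , m<n⇒m<1+n i<j , eq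
      ... | inj₂ (here x≡uj) = j , n<1+n j , x≡uj

      ∈-orbit⁺ : ∀ j {i} → i < j → u i ∈ orbit j
      ∈-orbit⁺ (suc j) i<1+j with m<1+n⇒m<n∨m≡n i<1+j
      ... | inj₁ i<j  = ∈-++⁺ˡ (∈-orbit⁺ j i<j)
      ... | inj₂ refl = ∈-++⁺ʳ (orbit j) (here refl)

      length-orbit : ∀ j → length (orbit j) ≡ j
      length-orbit zero    = refl
      length-orbit (suc j) = trans (length-++ (orbit j)) (trans (cong (_+ 1) (length-orbit j)) (+-comm j 1))

      unique-orbit : ∀ j → j ≤ p → Unique (orbit j)
      unique-orbit zero    _     = []
      unique-orbit (suc j) 1+j≤p = Unique.++⁺ (unique-orbit j (≤-trans (n≤1+n j) 1+j≤p)) ([] ∷ []) fresh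
        where
          fresh : ∀ {v} → ¬ (v ∈ orbit j × v ∈ (u j ∷ []))
          fresh (v∈ , here v≡uj) =
            let (i , i<j , v≡ui) = ∈-orbit⁻ j v∈
                (d , 1+i+d≡j) = m≤n⇒∃[o]m+o≡n i<j
                ui≡ : u i ≡ u (i + suc d)
                ui≡ = trans (sym v≡ui) (trans v≡uj (cong u (trans (sym 1+i+d≡j) (sym (+-suc i d)))))
                d<m : d < m
                d<m = ≤-trans (s≤s (m≤n+m d i)) (subst (_≤ m) (sym 1+i+d≡j) (s≤s⁻¹ 1+j≤p))
            in u-minimal d d<m (sym (u-cancel i (suc d) ui≡))

      partial : ℕ → Map n
      partial j = inv (u j) ∘ₘ ((g ^ₘ j) ∘ₘ t)

      partial∈Z : ∀ j → InZ (partial j)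
      partial∈Z j = ~⇒quotient∈Z (u∈G j) (subst (_~ ((g ^ₘ j) ∘ₘ t)) (sym (u≡rep j)) (rep~ (gʲt∈G j)))

      telescope : ∀ j → prod (map (τ g) (orbit j)) ≡ partial j
      telescope zero    = sym (trans (cong (inv t ∘ₘ_) (∘-identityˡ t)) (inverseˡ t∈G))
      telescope (suc j) = begin
        prod (map (τ g) (orbit j ++ (u j ∷ [])))
          ≡⟨ cong prod (map-++ (τ g) (orbit j) (u j ∷ [])) ⟩
        prod (map (τ g) (orbit j) ++ (τ g (u j) ∷ []))
          ≡⟨ prod-++ (map (τ g) (orbit j)) (τ g (u j) ∷ []) ⟩
        prod (map (τ g) (orbit j)) ∘ₘ (τ g (u j) ∘ₘ idMap)
          ≡⟨ cong₂ _∘ₘ_ (telescope j) (∘-identityʳ (τ g (u j))) ⟩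
        partial j ∘ₘ τ g (u j)
          ≡⟨ Z-commutes (partial∈Z j) (Z⊆G (τ∈Z gp (u∈G j))) ⟩
        (inv u′ ∘ₘ (g ∘ₘ u j)) ∘ₘ partial j
          ≡⟨ ∘-assoc (inv u′) (g ∘ₘ u j) (partial j) ⟩
        inv u′ ∘ₘ ((g ∘ₘ u j) ∘ₘ (inv (u j) ∘ₘ gʲt))
          ≡⟨ cong (inv u′ ∘ₘ_) (∘-assoc g (u j) (partial j)) ⟩
        inv u′ ∘ₘ (g ∘ₘ (u j ∘ₘ (inv (u j) ∘ₘ gʲt)))
          ≡⟨ cong (λ w → inv u′ ∘ₘ (g ∘ₘ w)) (inv-cancelˡ′ gʲt (u∈G j)) ⟩
        inv u′ ∘ₘ (g ∘ₘ gʲt)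
          ≡⟨ cong (inv u′ ∘ₘ_) (sym (∘-assoc g (g ^ₘ j) t)) ⟩
        partial (suc j) ∎
        where
          u′  = u (suc j)
          gʲt = (g ^ₘ j) ∘ₘ t

      cycle-product : prod (map (τ g) (orbit p)) ≡ g ^ₘ p
      cycle-product = trans (telescope p) (cancelʳ t∈G (begin
        partial p ∘ₘ t                          ≡⟨ Z-commutes (partial∈Z p) t∈G ⟩
        t ∘ₘ partial p                          ≡⟨ cong (λ w → t ∘ₘ (inv w ∘ₘ ((g ^ₘ p) ∘ₘ t))) u-period ⟩
        t ∘ₘ (inv t ∘ₘ ((g ^ₘ p) ∘ₘ t))         ≡⟨ inv-cancelˡ′ ((g ^ₘ p) ∘ₘ t) t∈G ⟩
        (g ^ₘ p) ∘ₘ t                           ∎))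

      module Remainder {R : List (Map n)} (uR : Unique R) (R⊆T : All (_∈ T) R)
                       (closedR : Closed R) (t∈R : t ∈ R) where
        open DecMembership (_≟ₘ_ {n}) using (_∈?_)

        outside? : ∀ x → Dec (¬ (x ∈ orbit p))
        outside? x = ¬? (x ∈? orbit p)

        rest : List (Map n)
        rest = filter outside? R

        ∈-rest⁻ : ∀ {x} → x ∈ rest → x ∈ R × ¬ (x ∈ orbit p)
        ∈-rest⁻ = ∈-filter⁻ outside? {xs = R}

        u∈R : ∀ j → u j ∈ R
        u∈R zero    = t∈R
        u∈R (suc j) = closedR (u∈R j)

        unique-rest : Unique rest
        unique-rest = Unique.filter⁺ outside? uR

        rest⊆T : All (_∈ T) rest
        rest⊆T = All.tabulate (λ x∈ → All.lookup R⊆T (proj₁ (∈-rest⁻ x∈)))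

        R↭ : R ↭ orbit p ++ rest
        R↭ = unique-↭ uR (Unique.++⁺ (unique-orbit p ≤-refl) unique-rest (λ (x∈O , x∈rest) → proj₂ (∈-rest⁻ x∈rest) x∈O)) ⊆++ ++⊆
          where
            ⊆++ : ∀ {x} → x ∈ R → x ∈ orbit p ++ rest
            ⊆++ {x} x∈ with x ∈? orbit p
            ... | yes x∈O = ∈-++⁺ˡ x∈O
            ... | no  x∉O = ∈-++⁺ʳ (orbit p) (∈-filter⁺ outside? x∈ x∉O)
            ++⊆ : ∀ {x} → x ∈ orbit p ++ rest → x ∈ R
            ++⊆ x∈ with ∈-++⁻ (orbit p) x∈
            ... | inj₁ x∈O    = let (i , _ , x≡ui) = ∈-orbit⁻ p x∈O in subst (_∈ R) (sym x≡ui) (u∈R i)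
            ... | inj₂ x∈rest = proj₁ (∈-rest⁻ x∈rest)

        -- the orbit is φ-closed, hence so is its complement in R
        rest-closed : Closed rest
        rest-closed {x} x∈ = ∈-filter⁺ outside? (closedR x∈R) φx∉O
          where
            x∈R = proj₁ (∈-rest⁻ x∈)
            x∉O = proj₂ (∈-rest⁻ x∈)
            xT  = All.lookup R⊆T x∈R
            φx∉O : ¬ (φ x ∈ orbit p)
            φx∉O φx∈O with ∈-orbit⁻ p φx∈O
            ... | zero , _ , φx≡t =
              x∉O (subst (_∈ orbit p) (sym (shift-injective gp xT (u∈T m) (trans φx≡t (sym u-period))))
                                      (∈-orbit⁺ p (n<1+n m)))
            ... | suc i , 1+i<p , φx≡ =
              x∉O (subst (_∈ orbit p) (sym (shift-injective gp xT (u∈T i) φx≡))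
                                      (∈-orbit⁺ p (≤-trans (n≤1+n (suc i)) 1+i<p)))

        length-R : length R ≡ p + length rest
        length-R = trans (↭.↭-length R↭) (trans (length-++ (orbit p)) (cong (_+ length rest) (length-orbit p)))

    -- ∏_{t ∈ R} τ(g,t) = g^|R| for every duplicate-free φ-closed R ⊆ T,
    -- by splitting off one cycle at a time (k bounds the length of R).
    evaluate : ∀ k R → length R ≤ k → Unique R → All (_∈ T) R → Closed R →
               prod (map (τ g) R) ≡ g ^ₘ length R
    evaluate _       []       _   _  _   _       = refl
    evaluate zero    (t ∷ R₀) ()  _  _   _
    evaluate (suc k) R@(t ∷ R₀) |R|≤ uR R⊆T closedR = begin
      prod (map (τ g) R)
        ≡⟨ prod-↭ (↭.map⁺ (τ g) R↭) (All.map⁺ (All.map (λ x∈T → τ∈Z gp (T⊆G x∈T)) R⊆T)) ⟩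
      prod (map (τ g) (orbit p ++ rest))                        ≡⟨ cong prod (map-++ (τ g) (orbit p) rest) ⟩
      prod (map (τ g) (orbit p) ++ map (τ g) rest)              ≡⟨ prod-++ (map (τ g) (orbit p)) (map (τ g) rest) ⟩
      prod (map (τ g) (orbit p)) ∘ₘ prod (map (τ g) rest)      ≡⟨ cong₂ _∘ₘ_ cycle-product IH ⟩
      (g ^ₘ p) ∘ₘ (g ^ₘ length rest)                            ≡⟨ sym (^-+ g p (length rest)) ⟩
      g ^ₘ (p + length rest)                                    ≡⟨ cong (g ^ₘ_) (sym length-R) ⟩
      g ^ₘ length R                                             ∎
      where
        open Cycle (All.lookup R⊆T (here refl))
        open Remainder uR R⊆T closedR (here refl)
        |rest|≤k : length rest ≤ k
        |rest|≤k = m+n≤o⇒n≤o m (s≤s⁻¹ (subst (_≤ suc k) length-R |R|≤))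
        IH : prod (map (τ g) rest) ≡ g ^ₘ length rest
        IH = evaluate k rest |rest|≤k unique-rest rest⊆T rest-closed

    V-eval : V g ≡ g ^ₘ N
    V-eval = evaluate N T ≤-refl unique-T (All.tabulate (λ t∈ → t∈)) (shift∈T gp)

  ^N∈Z : ∀ {g} → InG g → InZ (g ^ₘ N)
  ^N∈Z gp = subst InZ (Evaluation.V-eval gp) (V∈Z gp)

  ^N-hom : ∀ {g h} → InG g → InG h → (g ∘ₘ h) ^ₘ N ≡ (g ^ₘ N) ∘ₘ (h ^ₘ N)
  ^N-hom {g} {h} gp hp = begin
    (g ∘ₘ h) ^ₘ N      ≡⟨ sym (Evaluation.V-eval (∘∈ gp hp)) ⟩
    V (g ∘ₘ h)         ≡⟨ V-hom gp hp ⟩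
    V g ∘ₘ V h         ≡⟨ cong₂ _∘ₘ_ (Evaluation.V-eval gp) (Evaluation.V-eval hp) ⟩
    (g ^ₘ N) ∘ₘ (h ^ₘ N) ∎

module TransitiveGroup {n : ℕ} (G : PermGroup n) (transitive : Transitive G) (e' : ℕ)
                       (power-id : ∀ {g} → g ∈ elems G → g ^ₘ suc e' ≡ idMap) where
  open FiniteGroup G e' power-id
  open ≡-Reasoning

  central-fixing-point : ∀ {z ω} → InZ z → z · ω ≡ ω → z ≡ idMap
  central-fixing-point {z} {ω} z∈Z fix = map-ext λ β →
    let (a , a∈G , aω≡β) = transitive ω β in begin
      z · β         ≡⟨ cong (z ·_) (sym aω≡β) ⟩
      z · (a · ω)   ≡⟨ sym (·-∘ z a ω) ⟩
      (z ∘ₘ a) · ω  ≡⟨ cong (_· ω) (Z-commutes z∈Z a∈G) ⟩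
      (a ∘ₘ z) · ω  ≡⟨ ·-∘ a z ω ⟩
      a · (z · ω)   ≡⟨ cong (a ·_) fix ⟩
      a · ω         ≡⟨ aω≡β ⟩
      β             ≡⟨ sym (·-id β) ⟩
      idMap · β     ∎

  -- s^N is central and fixes the point fixed by s
  stabiliser-^N : ∀ {s} → InStabiliser G s → s ^ₘ N ≡ idMap
  stabiliser-^N {s} (s∈G , ω , fix) = central-fixing-point (^N∈Z s∈G) (^-fixes s ω fix N)

  G⁺⊆G : ∀ {k} → InGplus G k → InG k
  G⁺⊆G one              = hasId G
  G⁺⊆G (mul (s∈G , _) k) = ∘∈ s∈G (G⁺⊆G k)

  G⁺-^N : ∀ {k} → InGplus G k → k ^ₘ N ≡ idMap
  G⁺-^N one                  = idMap-^ N
  G⁺-^N (mul {s} {h} st hk) = begin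
    (s ∘ₘ h) ^ₘ N          ≡⟨ ^N-hom (proj₁ st) (G⁺⊆G hk) ⟩
    (s ^ₘ N) ∘ₘ (h ^ₘ N)   ≡⟨ cong₂ _∘ₘ_ (stabiliser-^N st) (G⁺-^N hk) ⟩
    idMap ∘ₘ idMap         ≡⟨ ∘-identityˡ idMap ⟩
    idMap                  ∎

  G⁺-∘ : ∀ {h h′} → InGplus G h → InGplus G h′ → InGplus G (h ∘ₘ h′)
  G⁺-∘ {h′ = h′} one k′ = subst (InGplus G) (sym (∘-identityˡ h′)) k′
  G⁺-∘ {h′ = h′} (mul {s} {h} st k) k′ = subst (InGplus G) (sym (∘-assoc s h h′)) (mul st (G⁺-∘ k k′))

  G⁺-^ : ∀ {h} → InGplus G h → ∀ k → InGplus G (h ^ₘ k)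
  G⁺-^ hk zero    = one
  G⁺-^ hk (suc k) = G⁺-∘ hk (G⁺-^ hk k)

  -- G⁺ is normal: conjugates of stabiliser elements are stabiliser elements
  G⁺-conj : ∀ {c h} → InG c → InGplus G h → InGplus G ((c ∘ₘ h) ∘ₘ inv c)
  G⁺-conj {c} cp one = subst (InGplus G) (sym (trans (cong (_∘ₘ inv c) (∘-identityʳ c)) (inverseʳ cp))) one
  G⁺-conj {c} cp (mul {s} {h} (s∈G , ω , fix) hk) = subst (InGplus G) (sym split) (mul s′-stab (G⁺-conj cp hk))
    where
      s′ = (c ∘ₘ s) ∘ₘ inv c
      s′-stab : InStabiliser G s′
      s′-stab = ∘∈ (∘∈ cp s∈G) (inv∈ cp) , c · ω , (begin
        ((c ∘ₘ s) ∘ₘ inv c) · (c · ω)  ≡⟨ ·-∘ (c ∘ₘ s) (inv c) (c · ω) ⟩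
        (c ∘ₘ s) · (inv c · (c · ω))   ≡⟨ cong ((c ∘ₘ s) ·_) (·-inv ω cp) ⟩
        (c ∘ₘ s) · ω                   ≡⟨ ·-∘ c s ω ⟩
        c · (s · ω)                    ≡⟨ cong (c ·_) fix ⟩
        c · ω                          ∎)
      split : (c ∘ₘ (s ∘ₘ h)) ∘ₘ inv c ≡ s′ ∘ₘ ((c ∘ₘ h) ∘ₘ inv c)
      split = begin
        (c ∘ₘ (s ∘ₘ h)) ∘ₘ inv c    ≡⟨ cong (_∘ₘ inv c) (sym (∘-assoc c s h)) ⟩
        ((c ∘ₘ s) ∘ₘ h) ∘ₘ inv c    ≡⟨ cong (λ w → (w ∘ₘ h) ∘ₘ inv c) (sym (inv-cancelʳ′ (c ∘ₘ s) cp)) ⟩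
        ((s′ ∘ₘ c) ∘ₘ h) ∘ₘ inv c   ≡⟨ cong (_∘ₘ inv c) (∘-assoc s′ c h) ⟩
        (s′ ∘ₘ (c ∘ₘ h)) ∘ₘ inv c   ≡⟨ ∘-assoc s′ (c ∘ₘ h) (inv c) ⟩
        s′ ∘ₘ ((c ∘ₘ h) ∘ₘ inv c)   ∎

  -- g^N depends only on the image g·ρ of one point: c⁻¹d ∈ G_ρ
  ^N-determined-at-point : ∀ {c d ρ} → InG c → InG d → c · ρ ≡ d · ρ → c ^ₘ N ≡ d ^ₘ N
  ^N-determined-at-point {c} {d} {ρ} cp dp cρ≡dρ = begin
    c ^ₘ N                ≡⟨ cong (_^ₘ N) (sym (inv-cancelˡ′ c dp)) ⟩
    (d ∘ₘ x) ^ₘ N         ≡⟨ ^N-hom dp x∈G ⟩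
    (d ^ₘ N) ∘ₘ (x ^ₘ N)  ≡⟨ cong ((d ^ₘ N) ∘ₘ_) (stabiliser-^N (x∈G , ρ , x-fixes)) ⟩
    (d ^ₘ N) ∘ₘ idMap     ≡⟨ ∘-identityʳ _ ⟩
    d ^ₘ N                ∎
    where
      x = inv d ∘ₘ c
      x∈G = ∘∈ (inv∈ dp) cp
      x-fixes : x · ρ ≡ ρ
      x-fixes = trans (·-∘ (inv d) c ρ) (trans (cong (inv d ·_) cρ≡dρ) (·-inv ρ dp))

  Same : Fin n → Fin n → Set
  Same = SameGplusOrbit G

  same-refl : ∀ α → Same α α
  same-refl α = idMap , one , ·-id α

  same-sym : ∀ {α β} → Same α β → Same β α
  same-sym {α} (h , hk , hα≡β) = inv h , G⁺-^ hk e' , trans (cong (inv h ·_) (sym hα≡β)) (·-inv α (G⁺⊆G hk))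

  same-trans : ∀ {α β γ} → Same α β → Same β γ → Same α γ
  same-trans {α} (h , hk , hα≡β) (h′ , hk′ , h′β≡γ) =
    h′ ∘ₘ h , G⁺-∘ hk′ hk , trans (·-∘ h′ h α) (trans (cong (h′ ·_) hα≡β) h′β≡γ)

  same-act : ∀ {c α β} → InG c → Same α β → Same (c · α) (c · β)
  same-act {c} {α} {β} cp (h , hk , hα≡β) = (c ∘ₘ h) ∘ₘ inv c , G⁺-conj cp hk , (begin
    ((c ∘ₘ h) ∘ₘ inv c) · (c · α)  ≡⟨ ·-∘ (c ∘ₘ h) (inv c) (c · α) ⟩
    (c ∘ₘ h) · (inv c · (c · α))   ≡⟨ cong ((c ∘ₘ h) ·_) (·-inv α cp) ⟩
    (c ∘ₘ h) · α                   ≡⟨ ·-∘ c h α ⟩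
    c · (h · α)                    ≡⟨ cong (c ·_) hα≡β ⟩
    c · β                          ∎)

  transversal-injective : ∀ {R} → AllPairs (λ α β → ¬ Same α β) R →
                          ∀ {α β} → α ∈ R → β ∈ R → Same α β → α ≡ β
  transversal-injective (_ ∷ _)  (here refl) (here refl) _ = refl
  transversal-injective (α∉ ∷ _) (here refl) (there β∈)  s = ⊥-elim (All.lookup α∉ β∈ s)
  transversal-injective (β∉ ∷ _) (there α∈)  (here refl) s = ⊥-elim (All.lookup β∉ α∈ (same-sym s))
  transversal-injective (_ ∷ ap) (there α∈)  (there β∈)  s = transversal-injective ap α∈ β∈ s

  G⁺-inv-^N : ∀ {h x} → InGplus G h → InG x → (inv h ∘ₘ x) ^ₘ N ≡ x ^ₘ N
  G⁺-inv-^N {h} {x} hk xp = begin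
    (inv h ∘ₘ x) ^ₘ N          ≡⟨ ^N-hom (inv∈ (G⁺⊆G hk)) xp ⟩
    (inv h ^ₘ N) ∘ₘ (x ^ₘ N)   ≡⟨ cong (_∘ₘ (x ^ₘ N)) (inv-^-id N (G⁺-^N hk)) ⟩
    idMap ∘ₘ (x ^ₘ N)          ≡⟨ ∘-identityˡ (x ^ₘ N) ⟩
    x ^ₘ N                     ∎

  -- g ∈ G permutes the G⁺-orbits; on a transversal R this is the map
  -- π sending ω to the representative of the orbit of g·ω.
  module OrbitAction {R : List (Fin n)} (transversal : IsGplusOrbitTransversal G R)
                     {g : Map n} (gp : InG g) where
    separated : AllPairs (λ α β → ¬ Same α β) R
    separated = proj₁ transversal

    π-spec : ∀ ω → Σ (Fin n) λ ρ → ρ ∈ R × Same ρ (g · ω)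
    π-spec ω = find (proj₂ transversal (g · ω))

    π : Fin n → Fin n
    π ω = proj₁ (π-spec ω)

    π∈R : ∀ ω → π ω ∈ R
    π∈R ω = proj₁ (proj₂ (π-spec ω))

    π-same : ∀ ω → Same (π ω) (g · ω)
    π-same ω = proj₂ (proj₂ (π-spec ω))

    unique-R : Unique R
    unique-R = AllPairs.map (λ ¬same α≡β → ¬same (subst (Same _) α≡β (same-refl _))) separated

    π-↭ : map π R ↭ R
    π-↭ = unique-↭ (unique-map⁺ π π-injective unique-R) unique-R ⊆R R⊆
      where
        π-injective : ∀ {α β} → α ∈ R → β ∈ R → π α ≡ π β → α ≡ β
        π-injective {α} {β} α∈ β∈ πα≡πβ = transversal-injective separated α∈ β∈
          (subst₂ Same (·-inv α gp) (·-inv β gp) (same-act (inv∈ gp) gα~gβ))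
          where
            gα~gβ : Same (g · α) (g · β)
            gα~gβ = same-trans (same-sym (π-same α)) (subst (λ w → Same w (g · β)) (sym πα≡πβ) (π-same β))
        ⊆R : ∀ {ρ} → ρ ∈ map π R → ρ ∈ R
        ⊆R ρ∈ = let (ω , _ , ρ≡πω) = ∈-map⁻ π ρ∈ in subst (_∈ R) (sym ρ≡πω) (π∈R ω)
        -- ρ is the image of the representative ρ′ of the orbit of g⁻¹·ρ
        R⊆ : ∀ {ρ} → ρ ∈ R → ρ ∈ map π R
        R⊆ {ρ} ρ∈ =
          let (ρ′ , ρ′∈ , ρ′~g⁻¹ρ) = find (proj₂ transversal (inv g · ρ))
              gρ′~ρ : Same (g · ρ′) ρ
              gρ′~ρ = subst (Same (g · ρ′)) (·-inv′ ρ gp) (same-act gp ρ′~g⁻¹ρ)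
          in subst (_∈ map π R) (transversal-injective separated (π∈R ρ′) ρ∈ (same-trans (π-same ρ′) gρ′~ρ))
                   (∈-map⁺ π ρ′∈)

    module WithBasePoint (ρ₀ : Fin n) where
      b : Fin n → Map n
      b ω = proj₁ (transitive ρ₀ ω)

      b∈G : ∀ ω → InG (b ω)
      b∈G ω = proj₁ (proj₂ (transitive ρ₀ ω))

      b-sends : ∀ ω → b ω · ρ₀ ≡ ω
      b-sends ω = proj₂ (proj₂ (transitive ρ₀ ω))

      bᴺ : Fin n → Map n
      bᴺ ω = b ω ^ₘ N

      -- gᴺ b(ω)ᴺ = b(π ω)ᴺ: the element h⁻¹ g b(ω), where h ∈ G⁺ maps
      -- π ω to g·ω, sends ρ₀ to π ω
      gᴺ-shifts-bᴺ : ∀ ω → (g ^ₘ N) ∘ₘ bᴺ ω ≡ bᴺ (π ω)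
      gᴺ-shifts-bᴺ ω = begin
        (g ^ₘ N) ∘ₘ bᴺ ω   ≡⟨ sym (^N-hom gp (b∈G ω)) ⟩
        (g ∘ₘ b ω) ^ₘ N    ≡⟨ sym (G⁺-inv-^N hk (∘∈ gp (b∈G ω))) ⟩
        c ^ₘ N             ≡⟨ ^N-determined-at-point c∈G (b∈G (π ω)) c-sends ⟩
        bᴺ (π ω)           ∎
        where
          h  = proj₁ (π-same ω)
          hk = proj₁ (proj₂ (π-same ω))
          c = inv h ∘ₘ (g ∘ₘ b ω)
          c∈G = ∘∈ (inv∈ (G⁺⊆G hk)) (∘∈ gp (b∈G ω))
          c-sends : c · ρ₀ ≡ b (π ω) · ρ₀
          c-sends = begin
            c · ρ₀                       ≡⟨ ·-∘ (inv h) (g ∘ₘ b ω) ρ₀ ⟩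
            inv h · ((g ∘ₘ b ω) · ρ₀)    ≡⟨ cong (inv h ·_) (·-∘ g (b ω) ρ₀) ⟩
            inv h · (g · (b ω · ρ₀))     ≡⟨ cong (λ w → inv h · (g · w)) (b-sends ω) ⟩
            inv h · (g · ω)              ≡⟨ cong (inv h ·_) (sym (proj₂ (proj₂ (π-same ω)))) ⟩
            inv h · (h · π ω)            ≡⟨ ·-inv (π ω) (G⁺⊆G hk) ⟩
            π ω                          ≡⟨ sym (b-sends (π ω)) ⟩
            b (π ω) · ρ₀                 ∎

      -- multiplying gᴺ bᴺ(ω) = bᴺ(π ω) over ω ∈ R and cancelling ∏ bᴺ
      gᴺ^|R|≡id : (g ^ₘ N) ^ₘ length R ≡ idMap
      gᴺ^|R|≡id = cancelʳ (Z⊆G (prod∈Z (bᴺ-central {R}))) (begin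
        ((g ^ₘ N) ^ₘ length R) ∘ₘ B         ≡⟨ cong (_∘ₘ B) (sym (prod-const (g ^ₘ N) R)) ⟩
        prod (map (λ _ → g ^ₘ N) R) ∘ₘ B    ≡⟨ sym (prod-map-∘ (λ _ → g ^ₘ N) bᴺ R (λ _ → ^N∈Z gp) (λ _ → ^N∈Z (b∈G _))) ⟩
        prod (map (λ ω → (g ^ₘ N) ∘ₘ bᴺ ω) R) ≡⟨ cong prod (map-cong-local {xs = R} (All.tabulate (λ {ω} _ → gᴺ-shifts-bᴺ ω))) ⟩
        prod (map (λ ω → bᴺ (π ω)) R)        ≡⟨ cong prod (map-∘ R) ⟩
        prod (map bᴺ (map π R))              ≡⟨ prod-↭ (↭.map⁺ bᴺ π-↭) (bᴺ-central {map π R}) ⟩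
        B                                    ≡⟨ sym (∘-identityˡ B) ⟩
        idMap ∘ₘ B                           ∎)
        where
          B = prod (map bᴺ R)
          bᴺ-central : ∀ {xs} → All InZ (map bᴺ xs)
          bᴺ-central = All.map⁺ (All.universal (λ ω → ^N∈Z (b∈G ω)) _)

  ^|R|N≡id : ∀ {R g} → IsGplusOrbitTransversal G R → InG g → g ^ₘ (length R * N) ≡ idMap
  ^|R|N≡id {[]}         _           _  = refl
  ^|R|N≡id {R@(ρ₀ ∷ _)} {g} transversal gp =
    trans (sym (^-* g N (length R))) (OrbitAction.WithBasePoint.gᴺ^|R|≡id transversal gp ρ₀)

^-mod : ∀ {n} (g : Map n) e′ M → g ^ₘ suc e′ ≡ idMap → g ^ₘ M ≡ g ^ₘ (M % suc e′)
^-mod g e′ M gᵉ≡id = begin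
  g ^ₘ M                                    ≡⟨ cong (g ^ₘ_) (m≡m%n+[m/n]*n M e) ⟩
  g ^ₘ (r + q * e)                          ≡⟨ ^-+ g r (q * e) ⟩
  (g ^ₘ r) ∘ₘ (g ^ₘ (q * e))                ≡⟨ cong ((g ^ₘ r) ∘ₘ_) (sym (^-* g e q)) ⟩
  (g ^ₘ r) ∘ₘ ((g ^ₘ e) ^ₘ q)               ≡⟨ cong (λ w → (g ^ₘ r) ∘ₘ (w ^ₘ q)) gᵉ≡id ⟩
  (g ^ₘ r) ∘ₘ (idMap ^ₘ q)                  ≡⟨ cong ((g ^ₘ r) ∘ₘ_) (idMap-^ q) ⟩
  (g ^ₘ r) ∘ₘ idMap                         ≡⟨ ∘-identityʳ (g ^ₘ r) ⟩
  g ^ₘ r                                    ∎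
  where
    open ≡-Reasoning
    e = suc e′
    r = M % e
    q = M / e

exponent-divides : ∀ {n} (G : PermGroup n) {e′} → IsExponent G (suc e′) →
                   ∀ M → (∀ {g} → g ∈ elems G → g ^ₘ M ≡ idMap) → suc e′ ∣ M
exponent-divides G {e′} (_ , power-id , minimal) M ᴹ≡id =
  m%n≡0⇒n∣m M (suc e′) (remainder-zero (M % suc e′) (m%n<n M (suc e′)) ʳ≡id)
  where
    ʳ≡id : ∀ {g} → g ∈ elems G → g ^ₘ (M % suc e′) ≡ idMap
    ʳ≡id gp = trans (sym (^-mod _ e′ M (power-id gp))) (ᴹ≡id gp)
    -- a positive r < e annihilating G would contradict minimality of e
    remainder-zero : ∀ r → r < suc e′ → (∀ {g} → g ∈ elems G → g ^ₘ r ≡ idMap) → r ≡ 0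
    remainder-zero zero    _   _   = refl
    remainder-zero (suc r) r<e ʳ≡id′ = ⊥-elim (<⇒≱ r<e (minimal (suc r) _ ʳ≡id′))

lemma4 : ∀ (n : ℕ) (G : PermGroup n) → Transitive G →
           ∀ (e i : ℕ) (reps : List (Fin n)) →
           IsExponent G e → IsCentreIndex G i → IsGplusOrbitTransversal G reps →
           e ∣ i * length reps
lemma4 n G transitive zero i reps (() , _) _ _
lemma4 n G transitive (suc e′) i reps exponent@(_ , power-id , _) index transversal =
  exponent-divides G exponent (i * length reps) annihilates
  where
    open TransitiveGroup G transitive e′ power-id
    open FiniteGroup G e′ power-id using (N; Z; Z-nonempty; index-formula)
    N≡i : N ≡ i
    N≡i = *-cancelʳ-≡ N i (length Z) {{Z-nonempty}} (trans index-formula (sym index))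
    annihilates : ∀ {g} → g ∈ elems G → g ^ₘ (i * length reps) ≡ idMap
    annihilates {g} gp =
      trans (cong (g ^ₘ_) (trans (*-comm i (length reps)) (cong (length reps *_) (sym N≡i))))
            (^|R|N≡id transversal gp)
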